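{- Consider an instance of splittable CLR, fix an optimal solution, and let $\psi^*$ and $\phi^*$ be its routing cost and opening cost. Let $\theta\ge 0$ be a constant, let $w'$ be defined by $w'(v,v')=w(v,v')$ for $v,v'\in V$ and $w'(u,v)=w(u,v)+\theta\phi(u)$ for $u\in U,v\in V$, and let $H$ be the complete graph on $V\cup\{r\}$ with costs $c(r,v)=\min_{u\in U}w'(u,v)$ and $c(v,v')=\min\{w'(v,v'),\,c(r,v)+c(r,v')\}$. If $C^*$ is a minimum-cost Hamiltonian cycle in $H$, then $c(C^*)\le\psi^*+2\theta\phi^*$.
   Context: CLR instance: complete graph on customers $V$ and depots $U$ with metric edge cost $w\ge0$, opening costs $\phi:U\to\mathbb{R}_{\ge0}$, demands $d:V\to\mathbb{R}_{>0}$, capacity $k>0$. A tour is a cycle containing exactly one depot, with cost equal to its total edge cost. A feasible solution of splittable CLR is $(O,\mathcal{I},x)$ with $O\subseteq U$, each tour's depot in $O$, and $x:V\times\mathcal{I}\to\mathbb{R}_{\ge0}$ with $\sum_{v\in V(I)}x_{vI}\le k$, $x_{vI}=0$ for $v\notin I$, $\sum_I x_{vI}=d(v)$. Routing cost $\sum_I w(I)$, opening cost $\sum_{u\in O}\phi(u)$; total cost is their sum.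
   Formalization: The edge costs $w$, opening costs $\phi$, demands $d$, capacity $k$, the constant $\theta$ and the splitting $x$ take values in ℚ rather than the reals. -}

module Defs where

open import Data.Nat using (ℕ; zero; suc)
open import Data.Fin using (Fin)
open import Data.Fin as F using ()
open import Data.Sum using (_⊎_; inj₁; inj₂)
open import Data.Maybe using (Maybe; just; nothing)
open import Data.Bool using (Bool; true; false; if_then_else_)
open import Data.List using (List; []; _∷_)
open import Data.List.Membership.Propositional using (_∈_; _∉_)
open import Data.List.Relation.Unary.Unique.Propositional using (Unique)
open import Data.Product using (_×_; Σ)
open import Data.Rational using (ℚ; 0ℚ; 1ℚ; _+_; _*_; _≤_; _<_; _⊓_)
open import Relation.Binary.PropositionalEquality using (_≡_)

sumFin : (n : ℕ) → (Fin n → ℚ) → ℚ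
sumFin zero f = 0ℚ
sumFin (suc n) f = f F.zero + sumFin n (λ i → f (F.suc i))

minFin : (m : ℕ) → (Fin (suc m) → ℚ) → ℚ
minFin zero f = f F.zero
minFin (suc m) f = f F.zero ⊓ minFin m (λ i → f (F.suc i))

-- Instance: customers V = Fin n, depots U = Fin (suc m).
-- The vertex set of the complete graph is V ⊎ U.

Vtx : ℕ → ℕ → Set
Vtx n m = Fin n ⊎ Fin (suc m)

record IsMetric {A : Set} (w : A → A → ℚ) : Set where
  field
    nonneg : ∀ a b → 0ℚ ≤ w a b
    diag   : ∀ a → w a a ≡ 0ℚ
    sym    : ∀ a b → w a b ≡ w b a
    tri    : ∀ a b c → w a c ≤ w a b + w b c

record CLRInstance (n m : ℕ) : Set where
  field
    w   : Vtx n m → Vtx n m → ℚ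
    φ   : Fin (suc m) → ℚ
    d   : Fin n → ℚ
    k   : ℚ
    w-metric : IsMetric w
    φ-nonneg : ∀ u → 0ℚ ≤ φ u
    d-pos    : ∀ v → 0ℚ < d v
    k-pos    : 0ℚ < k

-- Tours: a cycle through exactly one depot u and a nonempty sequence of
-- pairwise distinct customers v₁ … v_ℓ  (u, v₁, …, v_ℓ, u).

record Tour (n m : ℕ) : Set where
  constructor tour
  field
    depot     : Fin (suc m)
    first     : Fin n
    rest      : List (Fin n)
    distinct  : Unique (first ∷ rest)

customers : ∀ {n m} → Tour n m → List (Fin n)
customers t = Tour.first t ∷ Tour.rest t

pathBack : ∀ {n m} → (Vtx n m → Vtx n m → ℚ) → Fin (suc m) → Fin n → List (Fin n) → ℚ
pathBack w u v [] = w (inj₁ v) (inj₂ u)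
pathBack w u v (v' ∷ vs) = w (inj₁ v) (inj₁ v') + pathBack w u v' vs

tourCost : ∀ {n m} → (Vtx n m → Vtx n m → ℚ) → Tour n m → ℚ
tourCost w t = w (inj₂ (Tour.depot t)) (inj₁ (Tour.first t))
             + pathBack w (Tour.depot t) (Tour.first t) (Tour.rest t)

record Solution (n m : ℕ) : Set where
  field
    O     : Fin (suc m) → Bool
    t     : ℕ
    tours : Fin t → Tour n m
    x     : Fin n → Fin t → ℚ

module _ {n m : ℕ} (I : CLRInstance n m) where
  open CLRInstance I

  record Feasible (S : Solution n m) : Set where
    open Solution S
    field
      depot-open : ∀ i → O (Tour.depot (tours i)) ≡ true
      x-nonneg   : ∀ v i → 0ℚ ≤ x v i
      capacity   : ∀ i → sumFin n (λ v → x v i) ≤ k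
      x-support  : ∀ v i → v ∉ customers (tours i) → x v i ≡ 0ℚ
      demand     : ∀ v → sumFin (Solution.t S) (λ i → x v i) ≡ d v

  routingCost : Solution n m → ℚ
  routingCost S = sumFin (Solution.t S) (λ i → tourCost w (Solution.tours S i))

  openingCost : Solution n m → ℚ
  openingCost S = sumFin (suc m) (λ u → if Solution.O S u then φ u else 0ℚ)

  totalCost : Solution n m → ℚ
  totalCost S = routingCost S + openingCost S

  Optimal : Solution n m → Set
  Optimal S = Feasible S × (∀ S' → Feasible S' → totalCost S ≤ totalCost S')

  -- The auxiliary graph H on V ∪ {r}; r is represented by 'nothing'.

  w' : ℚ → Fin (suc m) → Fin n → ℚ
  w' θ u v = w (inj₂ u) (inj₁ v) + θ * φ u

  cr : ℚ → Fin n → ℚ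
  cr θ v = minFin m (λ u → w' θ u v)

  -- costs of H (the diagonal value is never used by a Hamiltonian cycle
  -- on ≥ 2 vertices; c(r,r) = 0 and c(v,v) = min(0, …) = 0)
  cH : ℚ → Maybe (Fin n) → Maybe (Fin n) → ℚ
  cH θ nothing nothing = 0ℚ
  cH θ nothing (just v) = cr θ v
  cH θ (just v) nothing = cr θ v
  cH θ (just v) (just v') = w (inj₁ v) (inj₁ v') ⊓ (cr θ v + cr θ v')

record HamCycle (A : Set) : Set where
  field
    start    : A
    rest     : List A
    distinct : Unique (start ∷ rest)
    covers   : ∀ a → a ∈ (start ∷ rest)

closeCost : {A : Set} → (A → A → ℚ) → A → A → List A → ℚ
closeCost c s a [] = c a s
closeCost c s a (b ∷ bs) = c a b + closeCost c s b bs

cycleCost : {A : Set} → (A → A → ℚ) → HamCycle A → ℚ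
cycleCost c C = closeCost c (HamCycle.start C) (HamCycle.start C) (HamCycle.rest C)

MinHamCycle : {A : Set} → (A → A → ℚ) → HamCycle A → Set
MinHamCycle c C = ∀ C' → cycleCost c C ≤ cycleCost c C'

{-# OPTIONS --safe #-}
-- Walk through the tours of the solution depot by depot: starting at the root r, for each depot u
-- visit the customers of all tours at u one tour after another, then return to r.  Every customer
-- has positive demand, so lies on some tour, and the walk visits every vertex of H.  Leaving r
-- towards a tour at u and returning to r each cost at most θ φ(u) plus the edge between u and
-- the tour, and passing from the end of one tour to the start of the next at the same depot costs
-- at most the two edges through u; hence the walk costs at most ψ* + 2θφ*.  The costs of H satisfy
-- the triangle inequality, so skipping repeated vertices shortcuts the walk to a Hamiltonian cycle
-- that is no more expensive, and C* is cheaper still.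
module Submission where

open import Defs
open import Data.Nat using (ℕ)
open import Data.Fin using (Fin)
open import Data.Maybe using (Maybe)
open import Data.Rational using (ℚ; 0ℚ; _+_; _*_; _≤_)

open import Data.Bool using (true; false; if_then_else_)
open import Data.Fin using (zero; suc; _≟_)
open import Data.Fin.Properties using (any?)
open import Data.List using (List; []; _∷_; _++_; map; filter; foldr; concat; concatMap; tabulate; deduplicate)
open import Data.List.Properties using (++-assoc; filter-none; map-tabulate)
open import Data.List.Membership.Propositional using (_∈_)
open import Data.List.Membership.Propositional.Properties
  using (∈-deduplicate⁺; ∈-filter⁺; ∈-map⁺; ∈-tabulate⁺; ∈-concat⁺′; ∈-++⁺ˡ)
import Data.List.Membership.DecPropositional as DecMembership
open import Data.List.Relation.Binary.Sublist.Propositional using (_⊆_; []; _∷_; _∷ʳ_; ⊆-trans)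
open import Data.List.Relation.Binary.Sublist.Propositional.Properties using (filter-⊆)
open import Data.List.Relation.Unary.All using (All; []; _∷_)
open import Data.List.Relation.Unary.All.Properties using (all-filter; tabulate⁺)
open import Data.List.Relation.Unary.Any using (here; there)
open import Data.List.Relation.Unary.Unique.DecPropositional.Properties using (deduplicate-!)
open import Data.Maybe using (just; nothing)
open import Data.Maybe.Properties using (≡-dec)
open import Data.Product using (∃; _,_)
open import Data.Sum using (inj₁; inj₂)
open import Data.Rational using (_⊓_; _<_; nonNegative)
open import Data.Rational.Properties
  using (≤-refl; ≤-trans; ≤-reflexive; <-irrefl; +-mono-≤; +-monoˡ-≤; +-monoʳ-≤; *-monoˡ-≤-nonNeg;
         +-identityˡ; +-identityʳ; +-assoc; +-comm; *-zeroʳ; *-distribˡ-+;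
         ⊓-glb; ⊓-sel; p⊓q≤p; p⊓q≤q; mono-≤-distrib-⊓; module ≤-Reasoning)
open import Data.Rational.Solver using (module +-*-Solver)
open import Function using (_∘_)
open import Relation.Binary.Definitions using (DecidableEquality)
open import Relation.Binary.PropositionalEquality
  using (_≡_; refl; sym; trans; cong; cong₂; subst; module ≡-Reasoning)
open import Relation.Nullary using (¬_; does; ¬?)
open import Relation.Nullary.Decidable using (decidable-stable)

open +-*-Solver using (solve; _:=_; _:+_; _:*_)

p≤p+q : ∀ p {q} → 0ℚ ≤ q → p ≤ p + q
p≤p+q p {q} 0≤q = subst (_≤ p + q) (+-identityʳ p) (+-monoʳ-≤ p 0≤q)

p≤q+p : ∀ p {q} → 0ℚ ≤ q → p ≤ q + p
p≤q+p p {q} 0≤q = subst (_≤ q + p) (+-identityˡ p) (+-monoˡ-≤ p 0≤q)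

≤-+⊓ : ∀ {a} p q r → a ≤ p + q → a ≤ p + r → a ≤ p + (q ⊓ r)
≤-+⊓ {a} p q r h₁ h₂ =
  subst (a ≤_) (sym (mono-≤-distrib-⊓ (+-monoʳ-≤ p) q r)) (⊓-glb h₁ h₂)

≤-⊓+ : ∀ {a} p q r → a ≤ p + r → a ≤ q + r → a ≤ (p ⊓ q) + r
≤-⊓+ {a} p q r h₁ h₂ =
  subst (a ≤_) (sym (mono-≤-distrib-⊓ (+-monoˡ-≤ r) p q)) (⊓-glb h₁ h₂)

sumFin-cong : ∀ k {f g : Fin k → ℚ} → (∀ i → f i ≡ g i) → sumFin k f ≡ sumFin k g
sumFin-cong ℕ.zero    f≗g = refl
sumFin-cong (ℕ.suc k) f≗g = cong₂ _+_ (f≗g zero) (sumFin-cong k (f≗g ∘ suc))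

sumFin-mono-≤ : ∀ k {f g : Fin k → ℚ} → (∀ i → f i ≤ g i) → sumFin k f ≤ sumFin k g
sumFin-mono-≤ ℕ.zero    f≤g = ≤-refl
sumFin-mono-≤ (ℕ.suc k) f≤g = +-mono-≤ (f≤g zero) (sumFin-mono-≤ k (f≤g ∘ suc))

sumFin-zero : ∀ k {f : Fin k → ℚ} → (∀ i → f i ≡ 0ℚ) → sumFin k f ≡ 0ℚ
sumFin-zero ℕ.zero    f≗0 = refl
sumFin-zero (ℕ.suc k) f≗0 = trans (cong₂ _+_ (f≗0 zero) (sumFin-zero k (f≗0 ∘ suc))) (+-identityʳ 0ℚ)

sumFin-distrib-+ : ∀ k (f g : Fin k → ℚ) → sumFin k (λ i → f i + g i) ≡ sumFin k f + sumFin k g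
sumFin-distrib-+ ℕ.zero    f g = sym (+-identityʳ 0ℚ)
sumFin-distrib-+ (ℕ.suc k) f g =
  trans (cong (f zero + g zero +_) (sumFin-distrib-+ k (f ∘ suc) (g ∘ suc)))
        (interchange (f zero) (g zero) (sumFin k (f ∘ suc)) (sumFin k (g ∘ suc)))
  where
  interchange : ∀ a b c d → (a + b) + (c + d) ≡ (a + c) + (b + d)
  interchange = solve 4 (λ a b c d → (a :+ b) :+ (c :+ d) := (a :+ c) :+ (b :+ d)) refl

*-distribˡ-sumFin : ∀ k q (f : Fin k → ℚ) → q * sumFin k f ≡ sumFin k (λ i → q * f i)
*-distribˡ-sumFin ℕ.zero    q f = *-zeroʳ q
*-distribˡ-sumFin (ℕ.suc k) q f =
  trans (*-distribˡ-+ q (f zero) (sumFin k (f ∘ suc))) (cong (q * f zero +_) (*-distribˡ-sumFin k q (f ∘ suc)))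

sumFin-indicator : ∀ k (i : Fin k) q → sumFin k (λ j → if does (i ≟ j) then q else 0ℚ) ≡ q
sumFin-indicator (ℕ.suc k) zero    q = trans (cong (q +_) (sumFin-zero k (λ _ → refl))) (+-identityʳ q)
sumFin-indicator (ℕ.suc k) (suc i) q = trans (+-identityˡ _) (sumFin-indicator k i q)

sumList : List ℚ → ℚ
sumList = foldr _+_ 0ℚ

sumList-tabulate : ∀ k (f : Fin k → ℚ) → sumList (tabulate f) ≡ sumFin k f
sumList-tabulate ℕ.zero    f = refl
sumList-tabulate (ℕ.suc k) f = cong (f zero +_) (sumList-tabulate k (f ∘ suc))

sumFin-fibres : ∀ {B : Set} k (key : B → Fin k) (f : B → ℚ) xs →
  sumFin k (λ j → sumList (map f (filter (λ x → key x ≟ j) xs))) ≡ sumList (map f xs)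
sumFin-fibres k key f []       = sumFin-zero k (λ _ → refl)
sumFin-fibres k key f (x ∷ xs) = begin
  sumFin k (λ j → sumList (map f (filter (λ y → key y ≟ j) (x ∷ xs))))
    ≡⟨ sumFin-cong k split ⟩
  sumFin k (λ j → (if does (key x ≟ j) then f x else 0ℚ) + sumList (map f (filter (λ y → key y ≟ j) xs)))
    ≡⟨ sumFin-distrib-+ k _ _ ⟩
  sumFin k (λ j → if does (key x ≟ j) then f x else 0ℚ)
    + sumFin k (λ j → sumList (map f (filter (λ y → key y ≟ j) xs)))
    ≡⟨ cong₂ _+_ (sumFin-indicator k (key x) (f x)) (sumFin-fibres k key f xs) ⟩
  f x + sumList (map f xs) ∎
  where
  open ≡-Reasoning
  split : ∀ j → sumList (map f (filter (λ y → key y ≟ j) (x ∷ xs)))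
              ≡ (if does (key x ≟ j) then f x else 0ℚ) + sumList (map f (filter (λ y → key y ≟ j) xs))
  split j with does (key x ≟ j)
  ... | true  = refl
  ... | false = sym (+-identityˡ _)

closeCost-++ : ∀ {A : Set} (c : A → A → ℚ) s a xs b ys →
  closeCost c s a (xs ++ b ∷ ys) ≡ closeCost c b a xs + closeCost c s b ys
closeCost-++ c s a []       b ys = refl
closeCost-++ c s a (x ∷ xs) b ys =
  trans (cong (c a x +_) (closeCost-++ c s x xs b ys)) (sym (+-assoc (c a x) _ _))

closeCost-concat : ∀ {A : Set} (c : A → A → ℚ) s k (G : Fin k → List A) →
  closeCost c s s (concat (tabulate (λ i → G i ++ s ∷ []))) ≡ sumFin k (λ i → closeCost c s s (G i)) + c s s
closeCost-concat c s ℕ.zero    G = sym (+-identityˡ (c s s))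
closeCost-concat {A} c s (ℕ.suc k) G = begin
  closeCost c s s ((G zero ++ s ∷ []) ++ rest)
    ≡⟨ cong (closeCost c s s) (++-assoc (G zero) (s ∷ []) rest) ⟩
  closeCost c s s (G zero ++ s ∷ rest)
    ≡⟨ closeCost-++ c s s (G zero) s rest ⟩
  closeCost c s s (G zero) + closeCost c s s rest
    ≡⟨ cong (closeCost c s s (G zero) +_) (closeCost-concat c s k (G ∘ suc)) ⟩
  closeCost c s s (G zero) + (sumFin k (λ i → closeCost c s s (G (suc i))) + c s s)
    ≡⟨ sym (+-assoc (closeCost c s s (G zero)) _ (c s s)) ⟩
  sumFin (ℕ.suc k) (λ i → closeCost c s s (G i)) + c s s ∎
  where
  open ≡-Reasoning
  rest : List A
  rest = concat (tabulate (λ i → G (suc i) ++ s ∷ []))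

deduplicate-⊆ : ∀ {A : Set} (_≟ᴬ_ : DecidableEquality A) xs → deduplicate _≟ᴬ_ xs ⊆ xs
deduplicate-⊆ _≟ᴬ_ []       = []
deduplicate-⊆ _≟ᴬ_ (x ∷ xs) = refl ∷ ⊆-trans (filter-⊆ (¬? ∘ (x ≟ᴬ_)) _) (deduplicate-⊆ _≟ᴬ_ xs)

shortcut : ∀ {A : Set} → DecidableEquality A → (s : A) (W : List A) → (∀ a → a ∈ s ∷ W) → HamCycle A
-- deduplicate _≟ᴬ_ (s ∷ W) unfolds definitionally to s ∷ rest.
shortcut _≟ᴬ_ s W covers = record
  { start    = s
  ; rest     = filter (¬? ∘ (s ≟ᴬ_)) (deduplicate _≟ᴬ_ W)
  ; distinct = deduplicate-! _≟ᴬ_ (s ∷ W)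
  ; covers   = λ a → ∈-deduplicate⁺ _≟ᴬ_ (covers a)
  }

module _ {A : Set} (c : A → A → ℚ) (c-triangle : ∀ a x b → c a b ≤ c a x + c x b) where

  closeCost-skip : ∀ s a x ys → closeCost c s a ys ≤ c a x + closeCost c s x ys
  closeCost-skip s a x []       = c-triangle a x s
  closeCost-skip s a x (y ∷ ys) =
    ≤-trans (+-monoˡ-≤ (closeCost c s y ys) (c-triangle a x y)) (≤-reflexive (+-assoc (c a x) (c x y) _))

  closeCost-mono-⊆ : ∀ s a {xs ys} → xs ⊆ ys → closeCost c s a xs ≤ closeCost c s a ys
  closeCost-mono-⊆ s a []            = ≤-refl
  closeCost-mono-⊆ s a {ys = y ∷ ys} (.y ∷ʳ xs⊆ys) =
    ≤-trans (closeCost-mono-⊆ s a xs⊆ys) (closeCost-skip s a y ys)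
  closeCost-mono-⊆ s a (refl ∷ xs⊆ys) = +-monoʳ-≤ (c a _) (closeCost-mono-⊆ s _ xs⊆ys)

  cycleCost-shortcut : (_≟ᴬ_ : DecidableEquality A) (s : A) (W : List A) (covers : ∀ a → a ∈ s ∷ W) →
    cycleCost c (shortcut _≟ᴬ_ s W covers) ≤ closeCost c s s W
  cycleCost-shortcut _≟ᴬ_ s W covers =
    closeCost-mono-⊆ s s (⊆-trans (filter-⊆ (¬? ∘ (s ≟ᴬ_)) _) (deduplicate-⊆ _≟ᴬ_ W))

minFin-≤ : ∀ m (f : Fin (ℕ.suc m) → ℚ) i → minFin m f ≤ f i
minFin-≤ ℕ.zero    f zero    = ≤-refl
minFin-≤ (ℕ.suc m) f zero    = p⊓q≤p (f zero) _
minFin-≤ (ℕ.suc m) f (suc i) = ≤-trans (p⊓q≤q (f zero) _) (minFin-≤ m (f ∘ suc) i)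

minFin-attained : ∀ m (f : Fin (ℕ.suc m) → ℚ) → ∃ λ i → minFin m f ≡ f i
minFin-attained ℕ.zero    f = zero , refl
minFin-attained (ℕ.suc m) f with ⊓-sel (f zero) (minFin m (f ∘ suc)) | minFin-attained m (f ∘ suc)
... | inj₁ min≡f₀ | _          = zero , min≡f₀
... | inj₂ min≡m  | i , m≡fi   = suc i , trans min≡m m≡fi

module _ {n m : ℕ} (I : CLRInstance n m) (θ : ℚ) (θ≥0 : 0ℚ ≤ θ) where
  open CLRInstance I
  open IsMetric w-metric using (nonneg; tri) renaming (sym to w-sym)

  θφ-nonNeg : ∀ u → 0ℚ ≤ θ * φ u
  θφ-nonNeg u = subst (_≤ θ * φ u) (*-zeroʳ θ) (*-monoˡ-≤-nonNeg θ {{nonNegative θ≥0}} (φ-nonneg u))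

  cr≤w' : ∀ u v → cr I θ v ≤ w' I θ u v
  cr≤w' u v = minFin-≤ m (λ u → w' I θ u v) u

  cr-nonNeg : ∀ v → 0ℚ ≤ cr I θ v
  cr-nonNeg v with minFin-attained m (λ u → w' I θ u v)
  ... | u , cr≡w' = subst (0ℚ ≤_) (sym cr≡w') (≤-trans (nonneg _ _) (p≤p+q _ (θφ-nonNeg u)))

  cr-lipschitz : ∀ v v' → cr I θ v ≤ w (inj₁ v) (inj₁ v') + cr I θ v'
  cr-lipschitz v v' with minFin-attained m (λ u → w' I θ u v')
  ... | u , cr≡w' = begin
    cr I θ v                           ≤⟨ cr≤w' u v ⟩
    w (inj₂ u) (inj₁ v) + θ * φ u      ≤⟨ +-monoˡ-≤ (θ * φ u) (tri _ (inj₁ v') _) ⟩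
    (wuv' + wv'v) + θ * φ u            ≡⟨ shuffle wuv' wv'v (θ * φ u) ⟩
    wv'v + w' I θ u v'                 ≡⟨ cong₂ _+_ (w-sym _ _) (sym cr≡w') ⟩
    w (inj₁ v) (inj₁ v') + cr I θ v'   ∎
    where
    open ≤-Reasoning
    wuv' wv'v : ℚ
    wuv' = w (inj₂ u) (inj₁ v')
    wv'v = w (inj₁ v') (inj₁ v)
    shuffle : ∀ a b c → (a + b) + c ≡ b + (a + c)
    shuffle = solve 3 (λ a b c → (a :+ b) :+ c := b :+ (a :+ c)) refl

  cr-lipschitz′ : ∀ v v' → cr I θ v ≤ cr I θ v' + w (inj₁ v') (inj₁ v)
  cr-lipschitz′ v v' =
    subst (cr I θ v ≤_) (trans (+-comm _ (cr I θ v')) (cong (cr I θ v' +_) (w-sym _ _))) (cr-lipschitz v v')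

  cH-triangle-customers : ∀ a x b →
    cH I θ (just a) (just b) ≤ cH I θ (just a) (just x) + cH I θ (just x) (just b)
  cH-triangle-customers a x b = ≤-⊓+ wax (ρa + ρx) (wxb ⊓ (ρx + ρb)) via-wax via-ρa+ρx
    where
    wab wax wxb ρa ρb ρx cab : ℚ
    wab = w (inj₁ a) (inj₁ b)
    wax = w (inj₁ a) (inj₁ x)
    wxb = w (inj₁ x) (inj₁ b)
    ρa = cr I θ a
    ρb = cr I θ b
    ρx = cr I θ x
    cab = wab ⊓ (ρa + ρb)

    ρa+ρb≤wax+ρx+ρb : ρa + ρb ≤ wax + (ρx + ρb)
    ρa+ρb≤wax+ρx+ρb = ≤-trans (+-monoˡ-≤ ρb (cr-lipschitz a x)) (≤-reflexive (+-assoc wax ρx ρb))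

    ρa+ρb≤ρa+ρx+wxb : ρa + ρb ≤ (ρa + ρx) + wxb
    ρa+ρb≤ρa+ρx+wxb =
      ≤-trans (+-monoʳ-≤ ρa (cr-lipschitz′ b x)) (≤-reflexive (sym (+-assoc ρa ρx wxb)))

    via-wax : cab ≤ wax + (wxb ⊓ (ρx + ρb))
    via-wax = ≤-+⊓ wax wxb (ρx + ρb) (≤-trans (p⊓q≤p wab _) (tri _ _ _))
                                     (≤-trans (p⊓q≤q wab _) ρa+ρb≤wax+ρx+ρb)

    via-ρa+ρx : cab ≤ (ρa + ρx) + (wxb ⊓ (ρx + ρb))
    via-ρa+ρx = ≤-+⊓ (ρa + ρx) wxb (ρx + ρb) (≤-trans (p⊓q≤q wab _) ρa+ρb≤ρa+ρx+wxb)
                     (≤-trans (p⊓q≤q wab _) (+-mono-≤ (p≤p+q ρa (cr-nonNeg x)) (p≤q+p ρb (cr-nonNeg x))))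

  cH-triangle : ∀ a x b → cH I θ a b ≤ cH I θ a x + cH I θ x b
  cH-triangle nothing  nothing  nothing  = ≤-refl
  cH-triangle nothing  nothing  (just b) = ≤-reflexive (sym (+-identityˡ (cr I θ b)))
  cH-triangle (just a) nothing  nothing  = ≤-reflexive (sym (+-identityʳ (cr I θ a)))
  cH-triangle nothing  (just x) nothing  = ≤-trans (cr-nonNeg x) (p≤p+q _ (cr-nonNeg x))
  cH-triangle (just a) nothing  (just b) = p⊓q≤q (w (inj₁ a) (inj₁ b)) _
  cH-triangle nothing  (just x) (just b) =
    ≤-+⊓ ρx (w (inj₁ x) (inj₁ b)) (ρx + ρb)
      (cr-lipschitz′ b x)
      (≤-trans (p≤q+p ρb (cr-nonNeg x)) (+-monoʳ-≤ ρx (p≤q+p ρb (cr-nonNeg x))))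
    where
    ρx ρb : ℚ
    ρx = cr I θ x
    ρb = cr I θ b
  cH-triangle (just a) (just x) nothing  =
    ≤-⊓+ (w (inj₁ a) (inj₁ x)) (ρa + ρx) ρx
      (cr-lipschitz a x)
      (≤-trans (p≤p+q ρa (cr-nonNeg x)) (+-monoˡ-≤ ρx (p≤p+q ρa (cr-nonNeg x))))
    where
    ρa ρx : ℚ
    ρa = cr I θ a
    ρx = cr I θ x
  cH-triangle (just a) (just x) (just b) = cH-triangle-customers a x b

  -- In H the root stands for all depots at once: leaving it towards depot u costs θ φ(u).
  depotDist : Fin (ℕ.suc m) → Maybe (Fin n) → ℚ
  depotDist u nothing  = θ * φ u
  depotDist u (just v) = w (inj₁ v) (inj₂ u)

  cH-via-depot : ∀ u a v → cH I θ a (just v) ≤ depotDist u a + w (inj₂ u) (inj₁ v)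
  cH-via-depot u nothing  v = subst (cr I θ v ≤_) (+-comm _ (θ * φ u)) (cr≤w' u v)
  cH-via-depot u (just a) v = ≤-trans (p⊓q≤p (w (inj₁ a) (inj₁ v)) _) (tri _ _ _)

  cH-root-via-depot : ∀ u a → cH I θ a nothing ≤ depotDist u a + θ * φ u
  cH-root-via-depot u nothing  = ≤-trans (θφ-nonNeg u) (p≤p+q _ (θφ-nonNeg u))
  cH-root-via-depot u (just v) = subst (λ d → cr I θ v ≤ d + θ * φ u) (w-sym _ _) (cr≤w' u v)

  ReturnBound : Fin (ℕ.suc m) → List (Maybe (Fin n)) → ℚ → Set
  ReturnBound u X K = ∀ a → closeCost (cH I θ) nothing a X ≤ depotDist u a + K

  pathBack-bound : ∀ u K v vs X → ReturnBound u X K →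
    closeCost (cH I θ) nothing (just v) (map just vs ++ X) ≤ pathBack w u v vs + K
  pathBack-bound u K v []        X bound = bound (just v)
  pathBack-bound u K v (v' ∷ vs) X bound = begin
    cH I θ (just v) (just v') + closeCost (cH I θ) nothing (just v') (map just vs ++ X)
      ≤⟨ +-mono-≤ (p⊓q≤p (w (inj₁ v) (inj₁ v')) _) (pathBack-bound u K v' vs X bound) ⟩
    w (inj₁ v) (inj₁ v') + (pathBack w u v' vs + K)
      ≡⟨ sym (+-assoc (w (inj₁ v) (inj₁ v')) _ K) ⟩
    pathBack w u v (v' ∷ vs) + K ∎
    where open ≤-Reasoning

  tour-bound : ∀ T X K → ReturnBound (Tour.depot T) X K →
    ReturnBound (Tour.depot T) (map just (customers T) ++ X) (tourCost w T + K)
  tour-bound (tour u f rest _) X K bound a = begin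
    cH I θ a (just f) + closeCost (cH I θ) nothing (just f) (map just rest ++ X)
      ≤⟨ +-mono-≤ (cH-via-depot u a f) (pathBack-bound u K f rest X bound) ⟩
    (depotDist u a + w (inj₂ u) (inj₁ f)) + (pathBack w u f rest + K)
      ≡⟨ reassoc (depotDist u a) (w (inj₂ u) (inj₁ f)) (pathBack w u f rest) K ⟩
    depotDist u a + ((w (inj₂ u) (inj₁ f) + pathBack w u f rest) + K) ∎
    where
    open ≤-Reasoning
    reassoc : ∀ d e p k → (d + e) + (p + k) ≡ d + ((e + p) + k)
    reassoc = solve 4 (λ d e p k → (d :+ e) :+ (p :+ k) := d :+ ((e :+ p) :+ k)) refl

  depotTours-bound : ∀ u ts → All (λ T → Tour.depot T ≡ u) ts →
    ReturnBound u (concatMap (map just ∘ customers) ts) (sumList (map (tourCost w) ts) + θ * φ u)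
  depotTours-bound u []       []          a =
    subst (λ k → cH I θ a nothing ≤ depotDist u a + k) (sym (+-identityˡ (θ * φ u))) (cH-root-via-depot u a)
  depotTours-bound u (T ∷ ts) (refl ∷ ps) a =
    subst (λ k → closeCost (cH I θ) nothing a (map just (customers T) ++ X) ≤ depotDist u a + k)
      (sym (+-assoc (tourCost w T) _ (θ * φ u)))
      (tour-bound T X _ (depotTours-bound u ts ps) a)
    where
    X : List (Maybe (Fin n))
    X = concatMap (map just ∘ customers) ts

  module _ (S : Solution n m) (feasible : Feasible I S) where
    open Solution S
    open Feasible feasible
    open DecMembership (_≟_ {n}) using (_∈?_)

    toursAt : Fin (ℕ.suc m) → List (Tour n m)
    toursAt u = filter (λ T → Tour.depot T ≟ u) (tabulate tours)

    tourCostsAt : Fin (ℕ.suc m) → ℚ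
    tourCostsAt u = sumList (map (tourCost w) (toursAt u))

    depotWalk : Fin (ℕ.suc m) → List (Maybe (Fin n))
    depotWalk u = concatMap (map just ∘ customers) (toursAt u)

    closedWalk : List (Maybe (Fin n))
    closedWalk = concat (tabulate (λ u → depotWalk u ++ nothing ∷ []))

    toursAt-closed : ∀ u → O u ≡ false → toursAt u ≡ []
    toursAt-closed u closed = filter-none (λ T → Tour.depot T ≟ u) (tabulate⁺ not-at-u)
      where
      not-at-u : ∀ i → ¬ Tour.depot (tours i) ≡ u
      not-at-u i refl with trans (sym (depot-open i)) closed
      ... | ()

    depotWalk-cost : ∀ u → closeCost (cH I θ) nothing nothing (depotWalk u)
                         ≤ tourCostsAt u + (θ + θ) * (if O u then φ u else 0ℚ)
    depotWalk-cost u with O u in O-u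
    ... | true  =
      ≤-trans (depotTours-bound u (toursAt u) at-u nothing) (≤-reflexive (double-charge θ (φ u) (tourCostsAt u)))
      where
      at-u : All (λ T → Tour.depot T ≡ u) (toursAt u)
      at-u = all-filter (λ T → Tour.depot T ≟ u) (tabulate tours)
      double-charge : ∀ t p s → t * p + (s + t * p) ≡ s + (t + t) * p
      double-charge = solve 3 (λ t p s → t :* p :+ (s :+ t :* p) := s :+ (t :+ t) :* p) refl
    ... | false rewrite toursAt-closed u O-u = ≤-reflexive (sym (trans (+-identityˡ _) (*-zeroʳ (θ + θ))))

    customer-served : ∀ v → ∃ λ i → v ∈ customers (tours i)
    customer-served v = decidable-stable (any? (λ i → v ∈? customers (tours i))) unserved-absurd
      where
      unserved-absurd : ¬ ¬ (∃ λ i → v ∈ customers (tours i))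
      unserved-absurd unserved = <-irrefl refl (subst (0ℚ <_) no-demand (d-pos v))
        where
        no-demand : d v ≡ 0ℚ
        no-demand = trans (sym (demand v)) (sumFin-zero t (λ i → x-support v i (λ v∈T → unserved (i , v∈T))))

    closedWalk-covers : ∀ a → a ∈ nothing ∷ closedWalk
    closedWalk-covers nothing  = here refl
    closedWalk-covers (just v) with customer-served v
    ... | i , v∈Tᵢ =
      there (∈-concat⁺′ (∈-++⁺ˡ v∈depotWalk) (∈-tabulate⁺ {f = λ u → depotWalk u ++ nothing ∷ []} u))
      where
      u : Fin (ℕ.suc m)
      u = Tour.depot (tours i)
      Tᵢ∈toursAt : tours i ∈ toursAt u
      Tᵢ∈toursAt = ∈-filter⁺ (λ T → Tour.depot T ≟ u) (∈-tabulate⁺ i) refl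
      v∈depotWalk : just v ∈ depotWalk u
      v∈depotWalk = ∈-concat⁺′ (∈-map⁺ just v∈Tᵢ) (∈-map⁺ (map just ∘ customers) Tᵢ∈toursAt)

    tours-regrouped : sumFin (ℕ.suc m) tourCostsAt ≡ routingCost I S
    tours-regrouped = begin
      sumFin (ℕ.suc m) tourCostsAt
        ≡⟨ sumFin-fibres (ℕ.suc m) Tour.depot (tourCost w) (tabulate tours) ⟩
      sumList (map (tourCost w) (tabulate tours))
        ≡⟨ cong sumList (map-tabulate tours (tourCost w)) ⟩
      sumList (tabulate (tourCost w ∘ tours))
        ≡⟨ sumList-tabulate t (tourCost w ∘ tours) ⟩
      routingCost I S ∎
      where open ≡-Reasoning

    closedWalk-cost : closeCost (cH I θ) nothing nothing closedWalk ≤ routingCost I S + (θ + θ) * openingCost I S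
    closedWalk-cost = begin
      closeCost (cH I θ) nothing nothing closedWalk
        ≡⟨ trans (closeCost-concat (cH I θ) nothing (ℕ.suc m) depotWalk) (+-identityʳ _) ⟩
      sumFin (ℕ.suc m) (λ u → closeCost (cH I θ) nothing nothing (depotWalk u))
        ≤⟨ sumFin-mono-≤ (ℕ.suc m) depotWalk-cost ⟩
      sumFin (ℕ.suc m) (λ u → tourCostsAt u + (θ + θ) * openCost u)
        ≡⟨ sumFin-distrib-+ (ℕ.suc m) tourCostsAt (λ u → (θ + θ) * openCost u) ⟩
      sumFin (ℕ.suc m) tourCostsAt + sumFin (ℕ.suc m) (λ u → (θ + θ) * openCost u)
        ≡⟨ cong₂ _+_ tours-regrouped (sym (*-distribˡ-sumFin (ℕ.suc m) (θ + θ) openCost)) ⟩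
      routingCost I S + (θ + θ) * openingCost I S ∎
      where
      open ≤-Reasoning
      openCost : Fin (ℕ.suc m) → ℚ
      openCost u = if O u then φ u else 0ℚ

lemma8 : ∀ {n m : ℕ} (I : CLRInstance n m) (S : Solution n m) → Optimal I S →
    (θ : ℚ) → 0ℚ ≤ θ →
    (C : HamCycle (Maybe (Fin n))) → MinHamCycle (cH I θ) C →
    cycleCost (cH I θ) C ≤ routingCost I S + (θ + θ) * openingCost I S
lemma8 {n} I S (feasible , _) θ θ≥0 C C-minimal = begin
  cycleCost (cH I θ) C                         ≤⟨ C-minimal C′ ⟩
  cycleCost (cH I θ) C′                        ≤⟨ cycleCost-shortcut (cH I θ) (cH-triangle I θ θ≥0) _ _ _ covers ⟩
  closeCost (cH I θ) nothing nothing walk      ≤⟨ closedWalk-cost I θ θ≥0 S feasible ⟩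
  routingCost I S + (θ + θ) * openingCost I S  ∎
  where
  open ≤-Reasoning
  walk : List (Maybe (Fin n))
  walk = closedWalk I θ θ≥0 S feasible
  covers : ∀ a → a ∈ nothing ∷ walk
  covers = closedWalk-covers I θ θ≥0 S feasible
  C′ : HamCycle (Maybe (Fin n))
  C′ = shortcut (≡-dec _≟_) nothing walk covers
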